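{- For $n,k\ge 0$, let $c_{n,k}$ be the number of $k$-element sets $R\subseteq\{0,1\}^n\setminus\{0\}$ such that the $k\times n$ matrix with row set $R$ is HCO. Then, as formal power series, $$\sum_{n\ge 0}\sum_{k\ge 0}c_{n,k}x^ny^k=\sum_{m=0}^{\infty}\frac{x^m}{(1-a_1x)(1-a_2x)\cdots(1-a_{m+1}x)},$$ where $a_i=(1+y)^i-1$.
   Context: - A $0$-$1$ matrix is CO if in every row the $1$'s (if any) form a single contiguous block. - Two columns $x,y$ are inharmonious if there are rows $i,j$ with $x_i=1,y_i=0,x_j=0,y_j=1$. - A matrix is HCO if it is CO and no two adjacent columns are inharmonious. The property does not depend on the order of the rows. The sets $R$ are called discrete interval sets in the linear sensor-dense regime. For $n=0$ the only such set is the empty set. -}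

module Defs where

open import Data.Bool using (Bool; true; false)
import Data.Bool.Properties as BoolP
open import Data.Nat using (ℕ; zero; suc; _∸_; _+_)
open import Data.Fin using (Fin; toℕ) renaming (_≤_ to _≤ᶠ_)
import Data.Fin.Properties as FinP
open import Data.Vec using (Vec; []; _∷_; lookup; replicate)
import Data.Vec.Properties as VecP
open import Data.List using (List; []; _∷_; map; _++_; filter; length)
open import Data.List.Relation.Unary.Any using (Any; any?)
open import Data.List.Relation.Unary.All using (All; all?)
open import Data.Integer using (ℤ; +_; _-_; _*_) renaming (_+_ to _+ℤ_)
open import Data.Product using (_×_; _,_)
open import Relation.Binary.PropositionalEquality using (_≡_)
open import Relation.Nullary using (¬_; Dec; yes; no; ¬?; _×-dec_; _→-dec_)
import Data.Nat.Properties as NatP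

-- 0-1 vectors and matrices
-- A row is a vector in {0,1}^n, encoded as Vec Bool n (true = 1).
-- A matrix with row set R is given by the list R of its rows;
-- column x of the matrix is the function r ↦ lookup r x.

allRows : (n : ℕ) → List (Vec Bool n)
allRows zero    = [] ∷ []
allRows (suc n) = map (false ∷_) (allRows n) ++ map (true ∷_) (allRows n)

nonzeroRows : (n : ℕ) → List (Vec Bool n)
nonzeroRows n = filter (λ r → ¬? (VecP.≡-dec BoolP._≟_ r (replicate n false))) (allRows n)

-- all k-element sublists (= k-element subsets, the list having no repeats)
combinations : {A : Set} → ℕ → List A → List (List A)
combinations zero    xs       = [] ∷ []
combinations (suc k) []       = []
combinations (suc k) (x ∷ xs) = map (x ∷_) (combinations k xs) ++ combinations (suc k) xs

ContiguousOnes : {n : ℕ} → Vec Bool n → Set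
ContiguousOnes {n} r =
  (i l j : Fin n) → i ≤ᶠ l → l ≤ᶠ j →
  lookup r i ≡ true → lookup r j ≡ true → lookup r l ≡ true

CO : {n : ℕ} → List (Vec Bool n) → Set
CO R = All ContiguousOnes R

Inharmonious : {n : ℕ} → List (Vec Bool n) → Fin n → Fin n → Set
Inharmonious R x y =
  Any (λ r → lookup r x ≡ true × lookup r y ≡ false) R ×
  Any (λ s → lookup s x ≡ false × lookup s y ≡ true) R

HCO : {n : ℕ} → List (Vec Bool n) → Set
HCO {n} R = CO R × ((x y : Fin n) → toℕ y ≡ suc (toℕ x) → ¬ Inharmonious R x y)

ContiguousOnes? : {n : ℕ} (r : Vec Bool n) → Dec (ContiguousOnes r)
ContiguousOnes? r =
  FinP.all? λ i → FinP.all? λ l → FinP.all? λ j →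
    (i FinP.≤? l) →-dec ((l FinP.≤? j) →-dec
      ((lookup r i BoolP.≟ true) →-dec ((lookup r j BoolP.≟ true) →-dec (lookup r l BoolP.≟ true))))

HCO? : {n : ℕ} (R : List (Vec Bool n)) → Dec (HCO R)
HCO? R =
  all? ContiguousOnes? R ×-dec
  (FinP.all? λ x → FinP.all? λ y →
    (toℕ y NatP.≟ suc (toℕ x)) →-dec ¬?
      (any? (λ r → (lookup r x BoolP.≟ true) ×-dec (lookup r y BoolP.≟ false)) R ×-dec
       any? (λ s → (lookup s x BoolP.≟ false) ×-dec (lookup s y BoolP.≟ true)) R))

c : ℕ → ℕ → ℕ
c n k = length (filter HCO? (combinations k (nonzeroRows n)))

-- Formal power series in x, y with integer coefficients:
-- F n k is the coefficient of x^n y^k.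

FPS : Set
FPS = ℕ → ℕ → ℤ

sumTo : ℕ → (ℕ → ℤ) → ℤ
sumTo zero    f = f 0
sumTo (suc n) f = sumTo n f +ℤ f (suc n)

zeroS : FPS
zeroS _ _ = + 0

oneS : FPS
oneS zero zero = + 1
oneS _    _    = + 0

xS : FPS
xS 1 zero = + 1
xS _ _    = + 0

yS : FPS
yS zero 1 = + 1
yS _    _ = + 0

_+S_ : FPS → FPS → FPS
(f +S g) n k = f n k +ℤ g n k

_-S_ : FPS → FPS → FPS
(f -S g) n k = f n k - g n k

_*S_ : FPS → FPS → FPS
(f *S g) n k = sumTo n λ p → sumTo k λ q → f p q * g (n ∸ p) (k ∸ q)

_^S_ : FPS → ℕ → FPS
f ^S zero  = oneS
f ^S suc j = f *S (f ^S j)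

-- 1/(1 - h) for a series h with zero constant term, defined as the
-- (locally finite) geometric series Σ_j h^j: since h^j only involves
-- monomials of total degree ≥ j, the coefficient of x^n y^k only
-- receives contributions from j ≤ n + k.
inv1m : FPS → FPS
inv1m h n k = sumTo (n + k) λ j → (h ^S j) n k

a : ℕ → FPS
a i = ((oneS +S yS) ^S i) -S oneS

prodInv : ℕ → FPS
prodInv zero    = oneS
prodInv (suc m) = prodInv m *S inv1m (a (suc m) *S xS)

term : ℕ → FPS
term m = (xS ^S m) *S prodInv (suc m)

-- Σ_{m ≥ 0} term m (locally finite: term m is divisible by x^m,
-- so the coefficient of x^n y^k only gets contributions from m ≤ n)
rhs : FPS
rhs n k = sumTo n λ m → term m n k

lhs : FPS
lhs n k = + (c n k)

module Submission where

-- Let D n i k be given by D 0 i k = [i = 1][k = 0] and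
--   D (n+1) i k = D n (i-1) k + Σ_{1≤s≤k} C(i,s) · D n i (k-s).
-- Both sides of the theorem have x^n y^k-coefficient Σ_{m≤n} D n (m+1) k.
--
-- The series D_i = Σ D n i k x^n y^k satisfy
-- D_i = x D_{i-1} + a_i x D_i, so D_{m+1} = x^m / Π_{i≤m+1} (1 - a_i x) is
-- the m-th summand of the right-hand side.  On coefficients, multiplying
-- P by 1/(1 - a_i x) gives Q with Q (n+1) = P (n+1) + a_i ⋆ Q n, where ⋆
-- is convolution of the y-coefficient sequences at fixed x-degree.
--
-- Split a row set S of width n+1 by its first column into
-- rows 0r (r ∈ R) and 1t (t ∈ T).  Call t admissible for R if the row 1t
-- can join the rows 0r without breaking HCO.  Then S is HCO iff R is HCO
-- and all of T is admissible, and the rows admissible for S number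
-- [T = ∅] + (rows admissible for R).  Hence the number of HCO sets with k
-- rows and i admissible rows satisfies the recursion of D, and summing over
-- i gives c n k.

open import Defs
open import Data.Bool using (Bool; true; false)
import Data.Bool.Properties as BoolP
open import Data.Nat as ℕ using (ℕ; zero; suc; _∸_; _+_; _*_; _≤_; _<_; z≤n; s≤s)
import Data.Nat.Properties as NP
open import Data.Integer using (ℤ; +_) renaming (_+_ to _+ℤ_; _*_ to _*ℤ_; _-_ to _-ℤ_)
import Data.Integer.Properties as ZP
import Algebra.Properties.CommutativeSemigroup as CommSemigroupProps
open import Data.Fin using (Fin; toℕ; zero; suc)
import Data.Fin.Properties as FinP
open import Data.Vec using (Vec; []; _∷_; lookup; replicate; head; tail)
import Data.Vec.Properties as VecP
open import Data.List using (List; []; _∷_; map; _++_; filter; length)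
import Data.List.Properties as ListP
open import Data.List.Relation.Unary.All as All using (All; []; _∷_; all?)
import Data.List.Relation.Unary.All.Properties as AllP
open import Data.List.Relation.Unary.Any as Any using (Any; here; there; any?)
import Data.List.Relation.Unary.Any.Properties as AnyP
open import Data.Product using (_×_; _,_; proj₁; proj₂)
open import Data.Sum using (inj₁; inj₂)
open import Data.List.Membership.Propositional using (lose)
open import Data.Empty using (⊥-elim)
open import Function using (_∘_)
open import Relation.Binary.PropositionalEquality
open import Relation.Nullary using (¬_; Dec; yes; no; ¬?; _×-dec_; _→-dec_)

sumTo-cong : ∀ n {f g : ℕ → ℤ} → (∀ i → i ≤ n → f i ≡ g i) → sumTo n f ≡ sumTo n g
sumTo-cong zero    e = e 0 z≤n
sumTo-cong (suc n) e = cong₂ _+ℤ_ (sumTo-cong n λ i i≤n → e i (NP.m≤n⇒m≤1+n i≤n)) (e (suc n) NP.≤-refl)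

sumTo-zero : ∀ n {f : ℕ → ℤ} → (∀ i → i ≤ n → f i ≡ + 0) → sumTo n f ≡ + 0
sumTo-zero n e = trans (sumTo-cong n e) (vanish n)
  where
  vanish : ∀ n → sumTo n (λ _ → + 0) ≡ + 0
  vanish zero    = refl
  vanish (suc n) = cong (_+ℤ + 0) (vanish n)

sumTo-+ : ∀ n (f g : ℕ → ℤ) → sumTo n (λ i → f i +ℤ g i) ≡ sumTo n f +ℤ sumTo n g
sumTo-+ zero    f g = refl
sumTo-+ (suc n) f g = trans (cong (_+ℤ (f (suc n) +ℤ g (suc n))) (sumTo-+ n f g))
  (CommSemigroupProps.interchange ZP.+-commutativeSemigroup (sumTo n f) (sumTo n g) (f (suc n)) (g (suc n)))

sumTo-*ˡ : ∀ n (x : ℤ) (f : ℕ → ℤ) → x *ℤ sumTo n f ≡ sumTo n (λ i → x *ℤ f i)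
sumTo-*ˡ zero    x f = refl
sumTo-*ˡ (suc n) x f = trans (ZP.*-distribˡ-+ x (sumTo n f) (f (suc n))) (cong (_+ℤ x *ℤ f (suc n)) (sumTo-*ˡ n x f))

sumTo-*ʳ : ∀ n (x : ℤ) (f : ℕ → ℤ) → sumTo n f *ℤ x ≡ sumTo n (λ i → f i *ℤ x)
sumTo-*ʳ zero    x f = refl
sumTo-*ʳ (suc n) x f = trans (ZP.*-distribʳ-+ x (sumTo n f) (f (suc n))) (cong (_+ℤ f (suc n) *ℤ x) (sumTo-*ʳ n x f))

sumTo-shift : ∀ n (f : ℕ → ℤ) → sumTo (suc n) f ≡ f 0 +ℤ sumTo n (λ i → f (suc i))
sumTo-shift zero    f = refl
sumTo-shift (suc n) f = trans (cong (_+ℤ f (suc (suc n))) (sumTo-shift n f)) (ZP.+-assoc (f 0) _ _)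

sumTo-single : ∀ n r {f : ℕ → ℤ} → r ≤ n → (∀ i → i ≤ n → i ≢ r → f i ≡ + 0) → sumTo n f ≡ f r
sumTo-single zero .zero z≤n e = refl
sumTo-single (suc n) r {f} r≤1+n e with r ℕ.≟ suc n
... | yes refl = trans (cong (_+ℤ f (suc n)) (sumTo-zero n λ i i≤n → e i (NP.m≤n⇒m≤1+n i≤n) (NP.<⇒≢ (s≤s i≤n))))
                       (ZP.+-identityˡ _)
... | no r≢1+n = trans (cong₂ _+ℤ_ (sumTo-single n r (NP.≤-pred (NP.≤∧≢⇒< r≤1+n r≢1+n)) λ i i≤n → e i (NP.m≤n⇒m≤1+n i≤n))
                                   (e (suc n) NP.≤-refl (r≢1+n ∘ sym)))
                       (ZP.+-identityʳ _)

sumTo-swap : ∀ n m (F : ℕ → ℕ → ℤ) →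
  sumTo n (λ i → sumTo m (F i)) ≡ sumTo m (λ j → sumTo n (λ i → F i j))
sumTo-swap zero    m F = refl
sumTo-swap (suc n) m F = trans (cong (_+ℤ sumTo m (F (suc n))) (sumTo-swap n m F))
                               (sym (sumTo-+ m (λ j → sumTo n (λ i → F i j)) (F (suc n))))

-- exchange of a triangular double sum: Σ_{p+r≤n} F p r, summed by p or by s = p + r
sumTo-triangle : ∀ n (F : ℕ → ℕ → ℤ) →
  sumTo n (λ p → sumTo (n ∸ p) (F p)) ≡ sumTo n (λ s → sumTo s (λ p → F p (s ∸ p)))
sumTo-triangle zero    F = refl
sumTo-triangle (suc n) F = begin
    sumTo n (λ p → sumTo (suc n ∸ p) (F p)) +ℤ sumTo (suc n ∸ suc n) (F (suc n))
  ≡⟨ cong₂ _+ℤ_ (sumTo-cong n λ p p≤n → cong (λ z → sumTo z (F p)) (NP.+-∸-assoc 1 p≤n))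
                (cong (λ z → sumTo z (F (suc n))) (NP.n∸n≡0 n)) ⟩
    sumTo n (λ p → sumTo (n ∸ p) (F p) +ℤ F p (suc (n ∸ p))) +ℤ F (suc n) 0
  ≡⟨ cong (_+ℤ F (suc n) 0) (sumTo-+ n _ _) ⟩
    (sumTo n (λ p → sumTo (n ∸ p) (F p)) +ℤ sumTo n (λ p → F p (suc (n ∸ p)))) +ℤ F (suc n) 0
  ≡⟨ ZP.+-assoc (sumTo n (λ p → sumTo (n ∸ p) (F p))) _ _ ⟩
    sumTo n (λ p → sumTo (n ∸ p) (F p)) +ℤ (sumTo n (λ p → F p (suc (n ∸ p))) +ℤ F (suc n) 0)
  ≡⟨ cong₂ _+ℤ_ (sumTo-triangle n F)
       (cong₂ _+ℤ_ (sumTo-cong n λ p p≤n → cong (F p) (sym (NP.+-∸-assoc 1 p≤n)))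
                   (cong (F (suc n)) (sym (NP.n∸n≡0 n)))) ⟩
    sumTo n (λ s → sumTo s (λ p → F p (s ∸ p))) +ℤ sumTo (suc n) (λ p → F p (suc n ∸ p))
  ∎
  where open ≡-Reasoning

sumTo-reverse : ∀ n (f : ℕ → ℤ) → sumTo n f ≡ sumTo n (λ i → f (n ∸ i))
sumTo-reverse zero    f = refl
sumTo-reverse (suc n) f = begin
    sumTo n f +ℤ f (suc n)
  ≡⟨ cong (_+ℤ f (suc n)) (sumTo-reverse n f) ⟩
    sumTo n (λ i → f (n ∸ i)) +ℤ f (suc n)
  ≡⟨ ZP.+-comm (sumTo n (λ i → f (n ∸ i))) (f (suc n)) ⟩
    f (suc n) +ℤ sumTo n (λ i → f (n ∸ i))
  ≡⟨ sym (sumTo-shift n (λ i → f (suc n ∸ i))) ⟩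
    sumTo (suc n) (λ i → f (suc n ∸ i))
  ∎
  where open ≡-Reasoning

-- Convolution of coefficient sequences in y.  The coefficient of x^n in a
-- product is  (f *S g) n = Σ_{p≤n} f p ⋆ g (n-p)  definitionally.

infixl 7 _⋆_
_⋆_ : (ℕ → ℤ) → (ℕ → ℤ) → ℕ → ℤ
(F ⋆ G) k = sumTo k (λ q → F q *ℤ G (k ∸ q))

⋆-cong : ∀ {F F′ G G′ : ℕ → ℤ} k → (∀ q → F q ≡ F′ q) → (∀ q → G q ≡ G′ q) → (F ⋆ G) k ≡ (F′ ⋆ G′) k
⋆-cong k eF eG = sumTo-cong k λ q _ → cong₂ _*ℤ_ (eF q) (eG _)

⋆-comm : ∀ (F G : ℕ → ℤ) k → (F ⋆ G) k ≡ (G ⋆ F) k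
⋆-comm F G k = trans (sumTo-reverse k _) (sumTo-cong k λ q q≤k →
  trans (ZP.*-comm (F (k ∸ q)) _) (cong (λ z → G z *ℤ F (k ∸ q)) (NP.m∸[m∸n]≡n q≤k)))

⋆-assoc : ∀ (F G H : ℕ → ℤ) k → (F ⋆ (G ⋆ H)) k ≡ ((F ⋆ G) ⋆ H) k
⋆-assoc F G H k = begin
    sumTo k (λ p → F p *ℤ sumTo (k ∸ p) (λ r → G r *ℤ H (k ∸ p ∸ r)))
  ≡⟨ sumTo-cong k (λ p _ → sumTo-*ˡ (k ∸ p) (F p) _) ⟩
    sumTo k (λ p → sumTo (k ∸ p) (λ r → F p *ℤ (G r *ℤ H (k ∸ p ∸ r))))
  ≡⟨ sumTo-triangle k (λ p r → F p *ℤ (G r *ℤ H (k ∸ p ∸ r))) ⟩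
    sumTo k (λ s → sumTo s (λ p → F p *ℤ (G (s ∸ p) *ℤ H (k ∸ p ∸ (s ∸ p)))))
  ≡⟨ sumTo-cong k (λ s _ → sumTo-cong s λ p p≤s →
       trans (sym (ZP.*-assoc (F p) _ _)) (cong (λ z → (F p *ℤ G (s ∸ p)) *ℤ H z)
         (trans (NP.∸-+-assoc k p (s ∸ p)) (cong (k ∸_) (NP.m+[n∸m]≡n p≤s))))) ⟩
    sumTo k (λ s → sumTo s (λ p → (F p *ℤ G (s ∸ p)) *ℤ H (k ∸ s)))
  ≡⟨ sumTo-cong k (λ s _ → sym (sumTo-*ʳ s (H (k ∸ s)) _)) ⟩
    sumTo k (λ s → (F ⋆ G) s *ℤ H (k ∸ s))
  ∎
  where open ≡-Reasoning

⋆-leftComm : ∀ (F G H : ℕ → ℤ) k → (F ⋆ (G ⋆ H)) k ≡ (G ⋆ (F ⋆ H)) k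
⋆-leftComm F G H k = begin
    (F ⋆ (G ⋆ H)) k   ≡⟨ ⋆-assoc F G H k ⟩
    ((F ⋆ G) ⋆ H) k   ≡⟨ ⋆-cong {G = H} k (⋆-comm F G) (λ _ → refl) ⟩
    ((G ⋆ F) ⋆ H) k   ≡⟨ sym (⋆-assoc G F H k) ⟩
    (G ⋆ (F ⋆ H)) k   ∎
  where open ≡-Reasoning

⋆-sumʳ : ∀ (F : ℕ → ℤ) j (G : ℕ → ℕ → ℤ) k →
  (F ⋆ (λ q → sumTo j (λ p → G p q))) k ≡ sumTo j (λ p → (F ⋆ G p) k)
⋆-sumʳ F j G k = trans (sumTo-cong k λ q _ → sumTo-*ˡ j (F q) _) (sumTo-swap k j _)

δ : ℕ → ℤ
δ = oneS 0

⋆-identityʳ : ∀ (F : ℕ → ℤ) k → (F ⋆ δ) k ≡ F k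
⋆-identityʳ F k = trans (sumTo-single k k NP.≤-refl λ q q≤k q≢k →
    trans (cong (F q *ℤ_) (δ-pos (k ∸ q) (NP.m<n⇒0<n∸m (NP.≤∧≢⇒< q≤k q≢k)))) (ZP.*-zeroʳ (F q)))
  (trans (cong (λ z → F k *ℤ δ z) (NP.n∸n≡0 k)) (ZP.*-identityʳ (F k)))
  where
  δ-pos : ∀ m → 0 < m → δ m ≡ + 0
  δ-pos (suc m) _ = refl

⋆-identityˡ : ∀ (F : ℕ → ℤ) k → (δ ⋆ F) k ≡ F k
⋆-identityˡ F k = trans (⋆-comm δ F k) (⋆-identityʳ F k)

⋆-zeroˡ : ∀ {F : ℕ → ℤ} (G : ℕ → ℤ) k → (∀ q → F q ≡ + 0) → (F ⋆ G) k ≡ + 0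
⋆-zeroˡ G k e = sumTo-zero k λ q _ → cong (_*ℤ G _) (e q)

⋆-zeroʳ : ∀ (F : ℕ → ℤ) {G : ℕ → ℤ} k → (∀ q → G q ≡ + 0) → (F ⋆ G) k ≡ + 0
⋆-zeroʳ F k e = sumTo-zero k λ q _ → trans (cong (F q *ℤ_) (e _)) (ZP.*-zeroʳ (F q))

-- Series of pure x-degree r: all monomials are x^r y^k.  Such a factor
-- turns a product into a single convolution in y.

XDegree : ℕ → FPS → Set
XDegree r f = ∀ n k → n ≢ r → f n k ≡ + 0

coeff-*S-XDegree : ∀ r {f} (g : FPS) n k → XDegree r f → r ≤ n → (f *S g) n k ≡ (f r ⋆ g (n ∸ r)) k
coeff-*S-XDegree r g n k hf r≤n =
  sumTo-single n r r≤n λ p _ p≢r → ⋆-zeroˡ (g (n ∸ p)) k λ q → hf p q p≢r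

*S-XDegree : ∀ r s {f g} → XDegree r f → XDegree s g → XDegree (r + s) (f *S g)
*S-XDegree r s {f} {g} hf hg n k n≢r+s = sumTo-zero n summand
  where
  summand : ∀ p → p ≤ n → (f p ⋆ g (n ∸ p)) k ≡ + 0
  summand p p≤n with p ℕ.≟ r
  ... | yes refl = ⋆-zeroʳ (f p) k λ q → hg (n ∸ p) q λ eq → n≢r+s (trans (sym (NP.m+[n∸m]≡n p≤n)) (cong (λ z → p + z) eq))
  ... | no p≢r   = ⋆-zeroˡ (g (n ∸ p)) k λ q → hf p q p≢r

oneS-XDegree : XDegree 0 oneS
oneS-XDegree zero    k 0≢0 = ⊥-elim (0≢0 refl)
oneS-XDegree (suc n) k _   = refl

yS-XDegree : XDegree 0 yS
yS-XDegree zero    k 0≢0 = ⊥-elim (0≢0 refl)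
yS-XDegree (suc n) k _   = refl

xS-XDegree : XDegree 1 xS
xS-XDegree zero          k _   = refl
xS-XDegree (suc zero)    k 1≢1 = ⊥-elim (1≢1 refl)
xS-XDegree (suc (suc n)) k _   = refl

+S-XDegree : ∀ r {f g} → XDegree r f → XDegree r g → XDegree r (f +S g)
+S-XDegree r hf hg n k n≢r = cong₂ _+ℤ_ (hf n k n≢r) (hg n k n≢r)

-S-XDegree : ∀ r {f g} → XDegree r f → XDegree r g → XDegree r (f -S g)
-S-XDegree r hf hg n k n≢r = cong₂ _-ℤ_ (hf n k n≢r) (hg n k n≢r)

^S-XDegree : ∀ r {f} → XDegree r f → ∀ j → XDegree (j * r) (f ^S j)
^S-XDegree r hf zero    = oneS-XDegree
^S-XDegree r hf (suc j) = *S-XDegree r (j * r) hf (^S-XDegree r hf j)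

xS-coeff : ∀ q → xS 1 q ≡ δ q
xS-coeff zero    = refl
xS-coeff (suc q) = refl

-- The coefficients of a_i = (1+y)^i - 1.  Binomial coefficients are
-- defined by Pascal's rule, which is what the computations below use.

binom : ℕ → ℕ → ℕ
binom _       zero    = 1
binom zero    (suc k) = 0
binom (suc n) (suc k) = binom n k + binom n (suc k)

-- coefficient of y^s in a_i: C(i,s) for s ≥ 1 and 0 for s = 0
aCoeff : ℕ → ℕ → ℕ
aCoeff i zero    = 0
aCoeff i (suc s) = binom i (suc s)

1+y-XDegree : XDegree 0 (oneS +S yS)
1+y-XDegree = +S-XDegree 0 oneS-XDegree yS-XDegree

1+y^-XDegree : ∀ i → XDegree 0 ((oneS +S yS) ^S i)
1+y^-XDegree i = subst (λ r → XDegree r ((oneS +S yS) ^S i)) (NP.*-zeroʳ i) (^S-XDegree 0 1+y-XDegree i)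

1+y^-coeff : ∀ i k → ((oneS +S yS) ^S i) 0 k ≡ + binom i k
1+y^-coeff zero    zero    = refl
1+y^-coeff zero    (suc k) = refl
1+y^-coeff (suc i) k       =
  trans (coeff-*S-XDegree 0 ((oneS +S yS) ^S i) 0 k 1+y-XDegree z≤n) (pascal k)
  where
  B : ℕ → ℤ
  B = ((oneS +S yS) ^S i) 0
  pascal : ∀ k → ((oneS +S yS) 0 ⋆ B) k ≡ + binom (suc i) k
  pascal zero    = trans (ZP.*-identityˡ (B 0)) (1+y^-coeff i 0)
  pascal (suc k) = begin
      sumTo (suc k) (λ q → (oneS +S yS) 0 q *ℤ B (suc k ∸ q))
    ≡⟨ sumTo-shift k _ ⟩
      + 1 *ℤ B (suc k) +ℤ sumTo k (λ q → (oneS +S yS) 0 (suc q) *ℤ B (k ∸ q))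
    ≡⟨ cong₂ _+ℤ_ (ZP.*-identityˡ (B (suc k)))
         (sumTo-single k 0 z≤n λ { zero _ 0≢0 → ⊥-elim (0≢0 refl) ; (suc q) _ _ → refl }) ⟩
      B (suc k) +ℤ + 1 *ℤ B k
    ≡⟨ cong₂ _+ℤ_ (1+y^-coeff i (suc k)) (trans (ZP.*-identityˡ (B k)) (1+y^-coeff i k)) ⟩
      + binom i (suc k) +ℤ + binom i k
    ≡⟨ ZP.+-comm (+ binom i (suc k)) (+ binom i k) ⟩
      + binom i k +ℤ + binom i (suc k)
    ≡⟨ sym (ZP.pos-+ (binom i k) _) ⟩
      + binom (suc i) (suc k)
    ∎
    where open ≡-Reasoning

a-XDegree : ∀ i → XDegree 0 (a i)
a-XDegree i = -S-XDegree 0 (1+y^-XDegree i) oneS-XDegree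

a-coeff : ∀ i q → a i 0 q ≡ + aCoeff i q
a-coeff i zero    = cong (_-ℤ + 1) (1+y^-coeff i 0)
a-coeff i (suc q) = trans (cong (_-ℤ + 0) (1+y^-coeff i (suc q))) (ZP.+-identityʳ _)

⋆-power : (ℕ → ℤ) → ℕ → ℕ → ℤ
⋆-power α zero    = δ
⋆-power α (suc j) = α ⋆ ⋆-power α j

module _ (i : ℕ) where

  a-x-XDegree : XDegree 1 (a i *S xS)
  a-x-XDegree = *S-XDegree 0 1 (a-XDegree i) xS-XDegree

  a-x^-XDegree : ∀ j → XDegree j ((a i *S xS) ^S j)
  a-x^-XDegree zero    = oneS-XDegree
  a-x^-XDegree (suc j) = *S-XDegree 1 j a-x-XDegree (a-x^-XDegree j)

  a-x^-coeff : ∀ j k → ((a i *S xS) ^S j) j k ≡ ⋆-power (a i 0) j k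
  a-x^-coeff zero    k = refl
  a-x^-coeff (suc j) k =
    trans (coeff-*S-XDegree 1 ((a i *S xS) ^S j) (suc j) k a-x-XDegree (s≤s z≤n))
          (⋆-cong k a-x-coeff (a-x^-coeff j))
    where
    a-x-coeff : ∀ q → (a i *S xS) 1 q ≡ a i 0 q
    a-x-coeff q = trans (coeff-*S-XDegree 0 xS 1 q (a-XDegree i) z≤n)
                        (trans (⋆-cong {F = a i 0} q (λ _ → refl) xS-coeff) (⋆-identityʳ (a i 0) q))

  -- only the term j = n of the geometric series contributes to x^n
  geom-coeff : ∀ n k → inv1m (a i *S xS) n k ≡ ⋆-power (a i 0) n k
  geom-coeff n k =
    trans (sumTo-single (n + k) n (NP.m≤m+n n k) λ j _ j≢n → a-x^-XDegree j n k (j≢n ∘ sym)) (a-x^-coeff n k)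

  divide-coeff : ∀ (P : FPS) n k →
    (P *S inv1m (a i *S xS)) n k ≡ sumTo n (λ p → (P p ⋆ ⋆-power (a i 0) (n ∸ p)) k)
  divide-coeff P n k = sumTo-cong n λ p _ → ⋆-cong {F = P p} k (λ _ → refl) (geom-coeff (n ∸ p))

  divide-coeff-zero : ∀ (P : FPS) k → (P *S inv1m (a i *S xS)) 0 k ≡ P 0 k
  divide-coeff-zero P k = trans (divide-coeff P 0 k) (⋆-identityʳ (P 0) k)

  divide-coeff-suc : ∀ (P : FPS) n k →
    (P *S inv1m (a i *S xS)) (suc n) k ≡ P (suc n) k +ℤ (a i 0 ⋆ (P *S inv1m (a i *S xS)) n) k
  divide-coeff-suc P n k = begin
      (P *S inv1m (a i *S xS)) (suc n) k
    ≡⟨ divide-coeff P (suc n) k ⟩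
      sumTo n (λ p → (P p ⋆ A (suc n ∸ p)) k) +ℤ (P (suc n) ⋆ A (n ∸ n)) k
    ≡⟨ cong₂ _+ℤ_ (sumTo-cong n λ p p≤n → trans (cong (λ z → (P p ⋆ A z) k) (NP.+-∸-assoc 1 p≤n))
                                                (⋆-leftComm (P p) (a i 0) (A (n ∸ p)) k))
                  (trans (cong (λ z → (P (suc n) ⋆ A z) k) (NP.n∸n≡0 n)) (⋆-identityʳ (P (suc n)) k)) ⟩
      sumTo n (λ p → (a i 0 ⋆ (P p ⋆ A (n ∸ p))) k) +ℤ P (suc n) k
    ≡⟨ cong (_+ℤ P (suc n) k) (sym (⋆-sumʳ (a i 0) n (λ p → P p ⋆ A (n ∸ p)) k)) ⟩
      (a i 0 ⋆ (λ q → sumTo n (λ p → (P p ⋆ A (n ∸ p)) q))) k +ℤ P (suc n) k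
    ≡⟨ cong (_+ℤ P (suc n) k) (⋆-cong {F = a i 0} k (λ _ → refl) (λ q → sym (divide-coeff P n q))) ⟩
      (a i 0 ⋆ (P *S inv1m (a i *S xS)) n) k +ℤ P (suc n) k
    ≡⟨ ZP.+-comm _ (P (suc n) k) ⟩
      P (suc n) k +ℤ (a i 0 ⋆ (P *S inv1m (a i *S xS)) n) k
    ∎
    where
    open ≡-Reasoning
    A = ⋆-power (a i 0)

sumN : ℕ → (ℕ → ℕ) → ℕ
sumN zero    f = f 0
sumN (suc n) f = sumN n f + f (suc n)

sumN-cast : ∀ n (f : ℕ → ℕ) → + sumN n f ≡ sumTo n (λ i → + f i)
sumN-cast zero    f = refl
sumN-cast (suc n) f = trans (ZP.pos-+ (sumN n f) (f (suc n))) (cong (_+ℤ + f (suc n)) (sumN-cast n f))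

sumN-cong : ∀ n {f g : ℕ → ℕ} → (∀ i → i ≤ n → f i ≡ g i) → sumN n f ≡ sumN n g
sumN-cong zero    e = e 0 z≤n
sumN-cong (suc n) e = cong₂ _+_ (sumN-cong n λ i i≤n → e i (NP.m≤n⇒m≤1+n i≤n)) (e (suc n) NP.≤-refl)

sumN-zero : ∀ n (f : ℕ → ℕ) → (∀ i → i ≤ n → f i ≡ 0) → sumN n f ≡ 0
sumN-zero zero    f e = e 0 z≤n
sumN-zero (suc n) f e = cong₂ _+_ (sumN-zero n f λ i i≤n → e i (NP.m≤n⇒m≤1+n i≤n)) (e (suc n) NP.≤-refl)

sumN-+ : ∀ n (f g : ℕ → ℕ) → sumN n (λ i → f i + g i) ≡ sumN n f + sumN n g
sumN-+ zero    f g = refl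
sumN-+ (suc n) f g = trans (cong (_+ (f (suc n) + g (suc n))) (sumN-+ n f g))
  (CommSemigroupProps.interchange NP.+-commutativeSemigroup (sumN n f) (sumN n g) (f (suc n)) (g (suc n)))

sumN-*ˡ : ∀ n (c : ℕ) (f : ℕ → ℕ) → c * sumN n f ≡ sumN n (λ i → c * f i)
sumN-*ˡ zero    c f = refl
sumN-*ˡ (suc n) c f = trans (NP.*-distribˡ-+ c (sumN n f) (f (suc n))) (cong (_+ c * f (suc n)) (sumN-*ˡ n c f))

sumN-shift : ∀ n (f : ℕ → ℕ) → sumN (suc n) f ≡ f 0 + sumN n (λ i → f (suc i))
sumN-shift zero    f = refl
sumN-shift (suc n) f = trans (cong (_+ f (suc (suc n))) (sumN-shift n f)) (NP.+-assoc (f 0) _ _)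

dropZero : (ℕ → ℕ) → ℕ → ℕ
dropZero f zero    = 0
dropZero f (suc s) = f (suc s)

sumN-dropZero : ∀ n (f : ℕ → ℕ) → sumN n f ≡ f 0 + sumN n (dropZero f)
sumN-dropZero zero    f = sym (NP.+-identityʳ (f 0))
sumN-dropZero (suc n) f = trans (cong (_+ f (suc n)) (sumN-dropZero n f)) (NP.+-assoc (f 0) _ _)

sumN-extend : ∀ M n (f : ℕ → ℕ) → n ≤ M → (∀ m → n < m → f m ≡ 0) → sumN M f ≡ sumN n f
sumN-extend zero    .zero f z≤n  e = refl
sumN-extend (suc M) n     f n≤1+M e with n ℕ.≟ suc M
... | yes refl = refl
... | no n≢1+M = trans (cong₂ _+_ (sumN-extend M n f (NP.≤-pred n<1+M) e) (e (suc M) n<1+M)) (NP.+-identityʳ _)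
  where n<1+M = NP.≤∧≢⇒< n≤1+M n≢1+M

-- The numbers D n i k (see the opening comment); i plays the role of the
-- number of admissible rows, D n i k the number of HCO sets of k rows in
-- n columns having i admissible rows.

D : ℕ → ℕ → ℕ → ℕ
D zero    (suc zero) zero = 1
D zero    _          _    = 0
D (suc n) zero       k    = sumN k (λ s → aCoeff 0 s * D n 0 (k ∸ s))
D (suc n) (suc i)    k    = D n i k + sumN k (λ s → aCoeff (suc i) s * D n (suc i) (k ∸ s))

-- no set has zero admissible rows
D-index-zero : ∀ n k → D n 0 k ≡ 0
D-index-zero zero    k = refl
D-index-zero (suc n) k = sumN-zero k _ λ s _ →
  trans (cong (aCoeff 0 s *_) (D-index-zero n (k ∸ s))) (NP.*-zeroʳ (aCoeff 0 s))

-- at most n+1 rows are ever admissible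
D-index-large : ∀ n i k → suc n < i → D n i k ≡ 0
D-index-large zero    (suc zero)    k (s≤s ())
D-index-large zero    (suc (suc i)) k _          = refl
D-index-large (suc n) (suc i)       k (s≤s n<i) = cong₂ _+_ (D-index-large n i k n<i) (sumN-zero k _ λ s _ →
  trans (cong (aCoeff (suc i) s *_) (D-index-large n (suc i) (k ∸ s) (NP.m≤n⇒m≤1+n n<i))) (NP.*-zeroʳ (aCoeff (suc i) s)))

a⋆-cast : ∀ i (E : ℕ → ℕ) (Q : ℕ → ℤ) k → (∀ q → Q q ≡ + E q) →
  (a i 0 ⋆ Q) k ≡ + sumN k (λ s → aCoeff i s * E (k ∸ s))
a⋆-cast i E Q k e = trans (sumTo-cong k λ q _ → trans (cong₂ _*ℤ_ (a-coeff i q) (e (k ∸ q))) (sym (ZP.pos-* (aCoeff i q) _)))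
                          (sym (sumN-cast k _))

prodInv-coeff : ∀ p n k → prodInv (suc p) n k ≡ + D (n + p) (suc p) k
prodInv-coeff zero zero k = trans (divide-coeff-zero 1 oneS k) (one-coeff k)
  where
  one-coeff : ∀ k → oneS 0 k ≡ + D 0 1 k
  one-coeff zero    = refl
  one-coeff (suc k) = refl
prodInv-coeff (suc p) zero k = begin
    prodInv (suc (suc p)) 0 k                            ≡⟨ divide-coeff-zero (suc (suc p)) (prodInv (suc p)) k ⟩
    prodInv (suc p) 0 k                                  ≡⟨ prodInv-coeff p 0 k ⟩
    + D p (suc p) k                                      ≡⟨ cong +_ (sym (NP.+-identityʳ _)) ⟩
    + (D p (suc p) k + 0)                                ≡⟨ cong (λ z → + (D p (suc p) k + z)) (sym no-new-term) ⟩
    + D (suc p) (suc (suc p)) k                          ∎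
  where
  open ≡-Reasoning
  no-new-term : sumN k (λ s → aCoeff (suc (suc p)) s * D p (suc (suc p)) (k ∸ s)) ≡ 0
  no-new-term = sumN-zero k _ λ s _ →
    trans (cong (aCoeff (suc (suc p)) s *_) (D-index-large p (suc (suc p)) (k ∸ s) NP.≤-refl)) (NP.*-zeroʳ (aCoeff (suc (suc p)) s))
prodInv-coeff zero (suc n) k = begin
    prodInv 1 (suc n) k                                  ≡⟨ divide-coeff-suc 1 oneS n k ⟩
    + 0 +ℤ (a 1 0 ⋆ prodInv 1 n) k                       ≡⟨ ZP.+-identityˡ _ ⟩
    (a 1 0 ⋆ prodInv 1 n) k                              ≡⟨ a⋆-cast 1 (D (n + 0) 1) (prodInv 1 n) k (prodInv-coeff zero n) ⟩
    + sumN k (λ s → aCoeff 1 s * D (n + 0) 1 (k ∸ s))    ≡⟨ cong (λ z → + (z + sumN k (λ s → aCoeff 1 s * D (n + 0) 1 (k ∸ s))))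
                                                              (sym (D-index-zero (n + 0) k)) ⟩
    + D (suc n + 0) 1 k                                  ∎
  where open ≡-Reasoning
prodInv-coeff (suc p) (suc n) k = begin
    prodInv (suc (suc p)) (suc n) k
  ≡⟨ divide-coeff-suc (suc (suc p)) (prodInv (suc p)) n k ⟩
    prodInv (suc p) (suc n) k +ℤ (a (suc (suc p)) 0 ⋆ prodInv (suc (suc p)) n) k
  ≡⟨ cong₂ _+ℤ_ (prodInv-coeff p (suc n) k) (a⋆-cast (suc (suc p)) _ _ k (prodInv-coeff (suc p) n)) ⟩
    + D (suc n + p) (suc p) k +ℤ + new
  ≡⟨ sym (ZP.pos-+ (D (suc n + p) (suc p) k) new) ⟩
    + (D (suc n + p) (suc p) k + new)
  ≡⟨ cong (λ z → + (D z (suc p) k + new)) (sym (NP.+-suc n p)) ⟩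
    + D (suc n + suc p) (suc (suc p)) k
  ∎
  where
  open ≡-Reasoning
  new = sumN k (λ s → aCoeff (suc (suc p)) s * D (n + suc p) (suc (suc p)) (k ∸ s))

x^-XDegree : ∀ m → XDegree m (xS ^S m)
x^-XDegree zero    = oneS-XDegree
x^-XDegree (suc m) = *S-XDegree 1 m xS-XDegree (x^-XDegree m)

x^-coeff : ∀ m q → (xS ^S m) m q ≡ δ q
x^-coeff zero    q = refl
x^-coeff (suc m) q = trans (coeff-*S-XDegree 1 (xS ^S m) (suc m) q xS-XDegree (s≤s z≤n))
                           (trans (⋆-cong q xS-coeff (x^-coeff m)) (⋆-identityˡ δ q))

term-coeff : ∀ m n k → m ≤ n → term m n k ≡ + D n (suc m) k
term-coeff m n k m≤n = begin
    term m n k                               ≡⟨ coeff-*S-XDegree m (prodInv (suc m)) n k (x^-XDegree m) m≤n ⟩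
    ((xS ^S m) m ⋆ prodInv (suc m) (n ∸ m)) k ≡⟨ ⋆-cong {G = prodInv (suc m) (n ∸ m)} k (x^-coeff m) (λ _ → refl) ⟩
    (δ ⋆ prodInv (suc m) (n ∸ m)) k          ≡⟨ ⋆-identityˡ (prodInv (suc m) (n ∸ m)) k ⟩
    prodInv (suc m) (n ∸ m) k                ≡⟨ prodInv-coeff m (n ∸ m) k ⟩
    + D (n ∸ m + m) (suc m) k                ≡⟨ cong (λ z → + D z (suc m) k) (NP.m∸n+n≡m m≤n) ⟩
    + D n (suc m) k                          ∎
  where open ≡-Reasoning

rhs-coeff : ∀ n k → rhs n k ≡ + sumN n (λ m → D n (suc m) k)
rhs-coeff n k = trans (sumTo-cong n λ m m≤n → term-coeff m n k m≤n) (sym (sumN-cast n _))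

𝟙 : {P : Set} → Dec P → ℕ
𝟙 (yes _) = 1
𝟙 (no _)  = 0

𝟙-⇔ : {P Q : Set} → (P → Q) → (Q → P) → (p : Dec P) (q : Dec Q) → 𝟙 p ≡ 𝟙 q
𝟙-⇔ f g (yes p) (yes q) = refl
𝟙-⇔ f g (yes p) (no ¬q) = ⊥-elim (¬q (f p))
𝟙-⇔ f g (no ¬p) (yes q) = ⊥-elim (¬p (g q))
𝟙-⇔ f g (no ¬p) (no ¬q) = refl

𝟙-≡ : ∀ {m n} → m ≡ n → ∀ v → 𝟙 (m ℕ.≟ v) ≡ 𝟙 (n ℕ.≟ v)
𝟙-≡ m≡n v = 𝟙-⇔ (trans (sym m≡n)) (trans m≡n) (_ ℕ.≟ v) (_ ℕ.≟ v)

𝟙-yes : {P : Set} → P → (p : Dec P) → 𝟙 p ≡ 1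
𝟙-yes x (yes _) = refl
𝟙-yes x (no ¬x) = ⊥-elim (¬x x)

𝟙-no : {P : Set} → ¬ P → (p : Dec P) → 𝟙 p ≡ 0
𝟙-no ¬x (yes x) = ⊥-elim (¬x x)
𝟙-no ¬x (no _)  = refl

𝟙≤1 : {P : Set} (p : Dec P) → 𝟙 p ≤ 1
𝟙≤1 (yes _) = s≤s z≤n
𝟙≤1 (no _)  = z≤n

sumL : {A : Set} → (A → ℕ) → List A → ℕ
sumL f []       = 0
sumL f (x ∷ xs) = f x + sumL f xs

count : {A : Set} {Q : A → Set} → ((x : A) → Dec (Q x)) → List A → ℕ
count Q? = sumL (λ x → 𝟙 (Q? x))

length-filter : {A : Set} {Q : A → Set} (Q? : (x : A) → Dec (Q x)) (xs : List A) →
  length (filter Q? xs) ≡ count Q? xs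
length-filter Q? []       = refl
length-filter Q? (x ∷ xs) with Q? x
... | yes _ = cong suc (length-filter Q? xs)
... | no _  = length-filter Q? xs

count≤length : {A : Set} {Q : A → Set} (Q? : (x : A) → Dec (Q x)) (xs : List A) → count Q? xs ≤ length xs
count≤length Q? []       = z≤n
count≤length Q? (x ∷ xs) = NP.+-mono-≤ (𝟙≤1 (Q? x)) (count≤length Q? xs)

module _ {A : Set} where

  sumL-cong : {f g : A → ℕ} (xs : List A) → (∀ x → f x ≡ g x) → sumL f xs ≡ sumL g xs
  sumL-cong []       e = refl
  sumL-cong (x ∷ xs) e = cong₂ _+_ (e x) (sumL-cong xs e)

  sumL-zero : (f : A → ℕ) (xs : List A) → (∀ x → f x ≡ 0) → sumL f xs ≡ 0
  sumL-zero f []       e = refl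
  sumL-zero f (x ∷ xs) e = cong₂ _+_ (e x) (sumL-zero f xs e)

  sumL-++ : (f : A → ℕ) (xs ys : List A) → sumL f (xs ++ ys) ≡ sumL f xs + sumL f ys
  sumL-++ f []       ys = refl
  sumL-++ f (x ∷ xs) ys = trans (cong (_+_ (f x)) (sumL-++ f xs ys)) (sym (NP.+-assoc (f x) _ _))

  sumL-map : {B : Set} (f : B → ℕ) (g : A → B) (xs : List A) → sumL f (map g xs) ≡ sumL (λ x → f (g x)) xs
  sumL-map f g []       = refl
  sumL-map f g (x ∷ xs) = cong (_+_ (f (g x))) (sumL-map f g xs)

  sumL-+ : (f g : A → ℕ) (xs : List A) → sumL (λ x → f x + g x) xs ≡ sumL f xs + sumL g xs
  sumL-+ f g []       = refl
  sumL-+ f g (x ∷ xs) = trans (cong (_+_ (f x + g x)) (sumL-+ f g xs))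
    (CommSemigroupProps.interchange NP.+-commutativeSemigroup (f x) (g x) (sumL f xs) (sumL g xs))

  sumL-*ˡ : (c : ℕ) (f : A → ℕ) (xs : List A) → c * sumL f xs ≡ sumL (λ x → c * f x) xs
  sumL-*ˡ c f []       = NP.*-zeroʳ c
  sumL-*ˡ c f (x ∷ xs) = trans (NP.*-distribˡ-+ c (f x) (sumL f xs)) (cong (_+_ (c * f x)) (sumL-*ˡ c f xs))

  sumL-*ʳ : (c : ℕ) (f : A → ℕ) (xs : List A) → sumL f xs * c ≡ sumL (λ x → f x * c) xs
  sumL-*ʳ c f []       = refl
  sumL-*ʳ c f (x ∷ xs) = trans (NP.*-distribʳ-+ c (f x) (sumL f xs)) (cong (_+_ (f x * c)) (sumL-*ʳ c f xs))

  sumL-sumN : (xs : List A) (n : ℕ) (F : A → ℕ → ℕ) →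
    sumL (λ x → sumN n (F x)) xs ≡ sumN n (λ s → sumL (λ x → F x s) xs)
  sumL-sumN []       n F = sym (sumN-zero n _ λ _ _ → refl)
  sumL-sumN (x ∷ xs) n F = trans (cong (_+_ (sumN n (F x))) (sumL-sumN xs n F)) (sym (sumN-+ n (F x) _))

sumN-δ : ∀ n v (g : ℕ → ℕ) → v ≤ n → sumN n (λ i → 𝟙 (v ℕ.≟ i) * g i) ≡ g v
sumN-δ zero .zero g z≤n = NP.+-identityʳ (g 0)
sumN-δ (suc n) v g v≤1+n with v ℕ.≟ suc n
... | yes refl = trans (cong (_+ (g (suc n) + 0)) (sumN-zero n _ λ i i≤n →
                         cong (_* g i) (𝟙-no (λ eq → NP.<⇒≢ (s≤s i≤n) (sym eq)) (suc n ℕ.≟ i))))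
                       (NP.+-identityʳ (g (suc n)))
... | no v≢1+n = trans (cong (_+ 0) (sumN-δ n v g (NP.≤-pred (NP.≤∧≢⇒< v≤1+n v≢1+n)))) (NP.+-identityʳ (g v))

sumN-δ-outside : ∀ n v (g : ℕ → ℕ) → n < v → sumN n (λ i → 𝟙 (v ℕ.≟ i) * g i) ≡ 0
sumN-δ-outside n v g n<v = sumN-zero n _ λ i i≤n →
  cong (_* g i) (𝟙-no (λ eq → NP.<⇒≢ (NP.≤-<-trans i≤n n<v) (sym eq)) (v ℕ.≟ i))

subsets : {A : Set} → List A → List (List A)
subsets []       = [] ∷ []
subsets (x ∷ xs) = map (x ∷_) (subsets xs) ++ subsets xs

sum-subsets-∷ : {A : Set} (F : List A → ℕ) (x : A) (xs : List A) →
  sumL F (subsets (x ∷ xs)) ≡ sumL (λ S → F (x ∷ S)) (subsets xs) + sumL F (subsets xs)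
sum-subsets-∷ F x xs = trans (sumL-++ F (map (x ∷_) (subsets xs)) (subsets xs))
                             (cong (_+ sumL F (subsets xs)) (sumL-map F (x ∷_) (subsets xs)))

sum-combinations : {A : Set} (k : ℕ) (L : List A) (w : List A → ℕ) →
  sumL w (combinations k L) ≡ sumL (λ S → 𝟙 (length S ℕ.≟ k) * w S) (subsets L)
sum-combinations zero    []       w = cong (_+ 0) (sym (NP.+-identityʳ (w [])))
sum-combinations (suc k) []       w = refl
sum-combinations zero    (x ∷ xs) w = sym (begin
    sumL (λ S → 𝟙 (length S ℕ.≟ 0) * w S) (subsets (x ∷ xs))
  ≡⟨ sum-subsets-∷ (λ S → 𝟙 (length S ℕ.≟ 0) * w S) x xs ⟩
    sumL (λ S → 𝟙 (suc (length S) ℕ.≟ 0) * w (x ∷ S)) (subsets xs) + sumL (λ S → 𝟙 (length S ℕ.≟ 0) * w S) (subsets xs)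
  ≡⟨ cong (_+ sumL (λ S → 𝟙 (length S ℕ.≟ 0) * w S) (subsets xs))
          (sumL-zero (λ S → 𝟙 (suc (length S) ℕ.≟ 0) * w (x ∷ S)) (subsets xs) λ _ → refl) ⟩
    sumL (λ S → 𝟙 (length S ℕ.≟ 0) * w S) (subsets xs)
  ≡⟨ sym (sum-combinations zero xs w) ⟩
    w [] + 0
  ∎)
  where open ≡-Reasoning
sum-combinations (suc k) (x ∷ xs) w = begin
    sumL w (map (x ∷_) (combinations k xs) ++ combinations (suc k) xs)
  ≡⟨ sumL-++ w (map (x ∷_) (combinations k xs)) (combinations (suc k) xs) ⟩
    sumL w (map (x ∷_) (combinations k xs)) + sumL w (combinations (suc k) xs)
  ≡⟨ cong₂ _+_ (trans (sumL-map w (x ∷_) (combinations k xs)) (sum-combinations k xs (λ S → w (x ∷ S))))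
               (sum-combinations (suc k) xs w) ⟩
    sumL (λ S → 𝟙 (length S ℕ.≟ k) * w (x ∷ S)) (subsets xs) + sumL (λ S → 𝟙 (length S ℕ.≟ suc k) * w S) (subsets xs)
  ≡⟨ cong (_+ _) (sumL-cong (subsets xs) λ S →
       cong (_* w (x ∷ S)) (𝟙-⇔ (cong suc) NP.suc-injective (length S ℕ.≟ k) (suc (length S) ℕ.≟ suc k))) ⟩
    sumL (λ S → 𝟙 (suc (length S) ℕ.≟ suc k) * w (x ∷ S)) (subsets xs) + sumL (λ S → 𝟙 (length S ℕ.≟ suc k) * w S) (subsets xs)
  ≡⟨ sym (sum-subsets-∷ (λ S → 𝟙 (length S ℕ.≟ suc k) * w S) x xs) ⟩
    sumL (λ S → 𝟙 (length S ℕ.≟ suc k) * w S) (subsets (x ∷ xs))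
  ∎
  where open ≡-Reasoning

sum-subsets-++ : {A : Set} (F : List A → ℕ) (L₁ L₂ : List A) →
  sumL F (subsets (L₁ ++ L₂)) ≡ sumL (λ S₁ → sumL (λ S₂ → F (S₁ ++ S₂)) (subsets L₂)) (subsets L₁)
sum-subsets-++ F []       L₂ = sym (NP.+-identityʳ _)
sum-subsets-++ F (x ∷ xs) L₂ = begin
    sumL F (subsets (x ∷ xs ++ L₂))
  ≡⟨ sum-subsets-∷ F x (xs ++ L₂) ⟩
    sumL (λ S → F (x ∷ S)) (subsets (xs ++ L₂)) + sumL F (subsets (xs ++ L₂))
  ≡⟨ cong₂ _+_ (sum-subsets-++ (λ S → F (x ∷ S)) xs L₂) (sum-subsets-++ F xs L₂) ⟩
    sumL (λ S₁ → G (x ∷ S₁)) (subsets xs) + sumL G (subsets xs)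
  ≡⟨ sym (sum-subsets-∷ G x xs) ⟩
    sumL G (subsets (x ∷ xs))
  ∎
  where
  open ≡-Reasoning
  G = λ S₁ → sumL (λ S₂ → F (S₁ ++ S₂)) (subsets L₂)

sum-subsets-map : {A B : Set} (F : List B → ℕ) (f : A → B) (L : List A) →
  sumL F (subsets (map f L)) ≡ sumL (λ S → F (map f S)) (subsets L)
sum-subsets-map F f []       = refl
sum-subsets-map F f (x ∷ xs) = begin
    sumL F (subsets (f x ∷ map f xs))
  ≡⟨ sum-subsets-∷ F (f x) (map f xs) ⟩
    sumL (λ S → F (f x ∷ S)) (subsets (map f xs)) + sumL F (subsets (map f xs))
  ≡⟨ cong₂ _+_ (sum-subsets-map (λ S → F (f x ∷ S)) f xs) (sum-subsets-map F f xs) ⟩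
    sumL (λ S → F (map f (x ∷ S))) (subsets xs) + sumL (λ S → F (map f S)) (subsets xs)
  ≡⟨ sym (sum-subsets-∷ (λ S → F (map f S)) x xs) ⟩
    sumL (λ S → F (map f S)) (subsets (x ∷ xs))
  ∎
  where open ≡-Reasoning

count-subsets-All : {A : Set} {Q : A → Set} (Q? : (x : A) → Dec (Q x)) (L : List A) (s : ℕ) →
  sumL (λ T → 𝟙 (all? Q? T) * 𝟙 (length T ℕ.≟ s)) (subsets L) ≡ binom (count Q? L) s
count-subsets-All Q? []       zero    = refl
count-subsets-All Q? []       (suc s) = refl
count-subsets-All {Q = Q} Q? (x ∷ xs) s =
  trans (sum-subsets-∷ (F s) x xs)
        (trans (cong (_+ sumL (F s) (subsets xs)) (sumL-cong (subsets xs) λ T → cong (_* _) (𝟙-all-∷ T)))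
               (by-head (Q? x) s))
  where
  F : ℕ → List _ → ℕ
  F s T = 𝟙 (all? Q? T) * 𝟙 (length T ℕ.≟ s)
  𝟙-all-∷ : ∀ T → 𝟙 (all? Q? (x ∷ T)) ≡ 𝟙 (Q? x) * 𝟙 (all? Q? T)
  𝟙-all-∷ T with Q? x | all? Q? T
  ... | yes _ | yes _ = refl
  ... | yes _ | no _  = refl
  ... | no _  | _     = refl
  -- x either may join an (s-1)-subset of xs (if Q x) or not
  by-head : (d : Dec (Q x)) → ∀ s →
    sumL (λ T → 𝟙 d * 𝟙 (all? Q? T) * 𝟙 (suc (length T) ℕ.≟ s)) (subsets xs) + sumL (F s) (subsets xs)
      ≡ binom (𝟙 d + count Q? xs) s
  by-head (yes _) zero    = cong₂ _+_
    (sumL-zero (λ T → 1 * 𝟙 (all? Q? T) * 𝟙 (suc (length T) ℕ.≟ 0)) (subsets xs) λ T → NP.*-zeroʳ (1 * 𝟙 (all? Q? T)))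
    (count-subsets-All Q? xs zero)
  by-head (yes _) (suc s) = cong₂ _+_
    (trans (sumL-cong (subsets xs) λ T → cong₂ _*_ (NP.+-identityʳ (𝟙 (all? Q? T)))
              (𝟙-⇔ NP.suc-injective (cong suc) (suc (length T) ℕ.≟ suc s) (length T ℕ.≟ s)))
           (count-subsets-All Q? xs s))
    (count-subsets-All Q? xs (suc s))
  by-head (no _)  s = trans (cong (_+ sumL (F s) (subsets xs)) (sumL-zero _ (subsets xs) λ _ → refl))
                            (count-subsets-All Q? xs s)

true≢false : true ≢ false
true≢false ()

contiguous-tail : ∀ {n} b (v : Vec Bool n) → ContiguousOnes (b ∷ v) → ContiguousOnes v
contiguous-tail b v co i l j i≤l l≤j vi vj = co (suc i) (suc l) (suc j) (s≤s i≤l) (s≤s l≤j) vi vj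

contiguous-0∷ : ∀ {n} {v : Vec Bool n} → ContiguousOnes v → ContiguousOnes (false ∷ v)
contiguous-0∷ co zero    l       j       _         _         ()  _
contiguous-0∷ co (suc i) zero    j       ()        _         _   _
contiguous-0∷ co (suc i) (suc l) zero    _         ()        _   _
contiguous-0∷ co (suc i) (suc l) (suc j) (s≤s i≤l) (s≤s l≤j) vi vj = co i l j i≤l l≤j vi vj

contiguous-1∷1∷ : ∀ {n} {t : Vec Bool n} → ContiguousOnes (true ∷ t) → ContiguousOnes (true ∷ true ∷ t)
contiguous-1∷1∷ co i       zero    j       _         _         _  _  = refl
contiguous-1∷1∷ co zero    (suc l) zero    _         ()        _  _
contiguous-1∷1∷ co zero    (suc l) (suc j) _         (s≤s l≤j) _  vj = co zero l j z≤n l≤j refl vj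
contiguous-1∷1∷ co (suc i) (suc l) zero    _         ()        _  _
contiguous-1∷1∷ co (suc i) (suc l) (suc j) (s≤s i≤l) (s≤s l≤j) vi vj = co i l j i≤l l≤j vi vj

contiguous-1∷-before : ∀ {n} {t : Vec Bool n} → ContiguousOnes (true ∷ t) → (x y : Fin (suc n)) →
  toℕ y ≡ suc (toℕ x) → lookup (true ∷ t) y ≡ true → lookup (true ∷ t) x ≡ true
contiguous-1∷-before co x y y≡1+x vy = co zero x y z≤n (subst (toℕ x ≤_) (sym y≡1+x) (NP.n≤1+n (toℕ x))) refl vy

-- the row 1t may be added to the rows 0r (r ∈ R): it is CO, and it forms
-- no inharmonious adjacent pair (1,0) / (0,1) with any row 0r
Admissible : ∀ {n} → List (Vec Bool n) → Vec Bool n → Set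
Admissible {n} R t = ContiguousOnes (true ∷ t) ×
  ((x y : Fin (suc n)) → toℕ y ≡ suc (toℕ x) → lookup (true ∷ t) x ≡ true → lookup (true ∷ t) y ≡ false →
    ¬ Any (λ s → lookup s x ≡ false × lookup s y ≡ true) (map (false ∷_) R))

Admissible? : ∀ {n} (R : List (Vec Bool n)) (t : Vec Bool n) → Dec (Admissible R t)
Admissible? R t = ContiguousOnes? (true ∷ t) ×-dec
  (FinP.all? λ x → FinP.all? λ y → (toℕ y NP.≟ suc (toℕ x)) →-dec
    ((lookup (true ∷ t) x BoolP.≟ true) →-dec ((lookup (true ∷ t) y BoolP.≟ false) →-dec
      ¬? (any? (λ s → (lookup s x BoolP.≟ false) ×-dec (lookup s y BoolP.≟ true)) (map (false ∷_) R)))))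

admissibleCount : ∀ {n} → List (Vec Bool n) → ℕ
admissibleCount {n} R = count (Admissible? R) (allRows n)

module _ {n : ℕ} (R T : List (Vec Bool n)) where
  private
    0R = map (false ∷_) R
    1T = map (true ∷_) T

  HCO-split⇒ : HCO (0R ++ 1T) → HCO R × All (Admissible R) T
  HCO-split⇒ (co , harm) =
    (All.map (contiguous-tail false _) (AllP.map⁻ (AllP.++⁻ˡ 0R co)) ,
     λ x y y≡1+x (r , s) → harm (suc x) (suc y) (cong suc y≡1+x) (AnyP.++⁺ˡ (AnyP.map⁺ r) , AnyP.++⁺ˡ (AnyP.map⁺ s))) ,
    All.tabulate λ {t} t∈T →
      All.lookup (AllP.map⁻ (AllP.++⁻ʳ 0R co)) t∈T ,
      λ x y y≡1+x tx ty s → harm x y y≡1+x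
        (AnyP.++⁺ʳ 0R (AnyP.map⁺ {P = λ r → lookup r x ≡ true × lookup r y ≡ false} (lose t∈T (tx , ty))) ,
         AnyP.++⁺ˡ s)

  HCO-split⇐ : HCO R → All (Admissible R) T → HCO (0R ++ 1T)
  HCO-split⇐ (co , harm) adm =
    AllP.++⁺ (AllP.map⁺ (All.map contiguous-0∷ co)) (AllP.map⁺ (All.map proj₁ adm)) , harmonious
    where
    harmonious : (x y : Fin (suc n)) → toℕ y ≡ suc (toℕ x) → ¬ Inharmonious (0R ++ 1T) x y
    harmonious x y y≡1+x (r , s) with AnyP.++⁻ 0R s
    -- a row 1t with t_x = 0, t_y = 1 is never CO
    ... | inj₂ s∈1T with All.lookupAny adm (AnyP.map⁻ s∈1T)
    ...   | (ok , sx , sy) = true≢false (trans (sym (contiguous-1∷-before (proj₁ ok) x y y≡1+x sy)) sx)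
    harmonious x y y≡1+x (r , s) | inj₁ s∈0R with AnyP.++⁻ 0R r
    -- a row 1t against a row 0r: excluded by admissibility
    ... | inj₂ r∈1T with All.lookupAny adm (AnyP.map⁻ r∈1T)
    ...   | (ok , rx , ry) = proj₂ ok x y y≡1+x rx ry s∈0R
    -- two rows 0r, 0r′: column 0 is constant, the others come from R
    harmonious zero    y       _       (r , s) | inj₁ s∈0R | inj₁ r∈0R with Any.satisfied (AnyP.map⁻ r∈0R)
    ... | (_ , () , _)
    harmonious (suc x) zero    ()      _       | inj₁ _    | inj₁ _
    harmonious (suc x) (suc y) y≡1+x   _       | inj₁ s∈0R | inj₁ r∈0R =
      harm x y (NP.suc-injective y≡1+x) (AnyP.map⁻ r∈0R , AnyP.map⁻ s∈0R)

-- The admissible rows of S = 0R ∪ 1T: the zero row is admissible exactly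
-- when T = ∅, other rows 0t never are, and 1t is admissible iff t is
-- admissible for R.

isZero : ℕ → ℕ
isZero zero    = 1
isZero (suc _) = 0

zeroRow : ∀ n → Vec Bool n
zeroRow n = replicate n false

zeroRow-no-one : ∀ n (j : Fin n) → lookup (zeroRow n) j ≢ true
zeroRow-no-one n j e = true≢false (trans (sym e) (VecP.lookup-replicate j false))

count-zeroRow : ∀ n → count (λ t → VecP.≡-dec BoolP._≟_ t (zeroRow n)) (allRows n) ≡ 1
count-zeroRow zero    = refl
count-zeroRow (suc n) = begin
    count Z? (map (false ∷_) (allRows n) ++ map (true ∷_) (allRows n))
  ≡⟨ sumL-++ _ (map (false ∷_) (allRows n)) (map (true ∷_) (allRows n)) ⟩
    count Z? (map (false ∷_) (allRows n)) + count Z? (map (true ∷_) (allRows n))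
  ≡⟨ cong₂ _+_
       (trans (sumL-map _ (false ∷_) (allRows n)) (trans (sumL-cong (allRows n) λ t →
          𝟙-⇔ (cong tail) (cong (false ∷_)) (Z? (false ∷ t)) (VecP.≡-dec BoolP._≟_ t (zeroRow n)))
          (count-zeroRow n)))
       (trans (sumL-map _ (true ∷_) (allRows n)) (sumL-zero _ (allRows n) λ t →
          𝟙-no (true≢false ∘ cong head) (Z? (true ∷ t)))) ⟩
    1
  ∎
  where
  open ≡-Reasoning
  Z? = λ (t : Vec Bool (suc n)) → VecP.≡-dec BoolP._≟_ t (zeroRow (suc n))

admissible-0∷⇒zero : ∀ {n} (S : List (Vec Bool (suc n))) (t : Vec Bool n) → Admissible S (false ∷ t) → t ≡ zeroRow n
admissible-0∷⇒zero S t (co , _) = all-false t λ i ti → true≢false (sym (co zero (suc zero) (suc (suc i)) z≤n (s≤s z≤n) refl ti))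
  where
  all-false : ∀ {m} (v : Vec Bool m) → (∀ i → lookup v i ≢ true) → v ≡ zeroRow m
  all-false []          no-one = refl
  all-false (true ∷ v)  no-one = ⊥-elim (no-one zero refl)
  all-false (false ∷ v) no-one = cong (false ∷_) (all-false v (no-one ∘ suc))

admissible-0∷⇒no-leading-one : ∀ {n} (S : List (Vec Bool (suc n))) (t : Vec Bool n) →
  Any (λ r → lookup r zero ≡ true) S → ¬ Admissible S (false ∷ t)
admissible-0∷⇒no-leading-one S t leading-one (_ , harm) =
  harm zero (suc zero) refl refl refl (AnyP.map⁺ (Any.map (refl ,_) leading-one))

zero-admissible : ∀ {n} (S : List (Vec Bool (suc n))) → All (λ r → lookup r zero ≡ false) S →
  Admissible S (false ∷ zeroRow n)
zero-admissible {n} S leading-zero = co , harm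
  where
  co : ContiguousOnes (true ∷ false ∷ zeroRow n)
  co i zero    j             _ _  _ _  = refl
  co i (suc l) zero          _ () _ _
  co i (suc l) (suc zero)    _ _  _ ()
  co i (suc l) (suc (suc j)) _ _  _ vj = ⊥-elim (zeroRow-no-one n j vj)
  harm : (x y : Fin (suc (suc n))) → toℕ y ≡ suc (toℕ x) → lookup (true ∷ false ∷ zeroRow n) x ≡ true →
         lookup (true ∷ false ∷ zeroRow n) y ≡ false →
         ¬ Any (λ s → lookup s x ≡ false × lookup s y ≡ true) (map (false ∷_) S)
  harm zero          zero          ()
  harm zero          (suc zero)    _  _  _ s with All.lookupAny leading-zero (AnyP.map⁻ s)
  ... | (s0 , _ , s1) = true≢false (trans (sym s1) s0)
  harm zero          (suc (suc y)) ()
  harm (suc zero)    y             _  ()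
  harm (suc (suc x)) y             _  vx = ⊥-elim (zeroRow-no-one n x vx)

module _ {n : ℕ} (R T : List (Vec Bool n)) where
  private
    S = map (false ∷_) R ++ map (true ∷_) T

  count-admissible-0∷ : count (λ t → Admissible? S (false ∷ t)) (allRows n) ≡ isZero (length T)
  count-admissible-0∷ = by-cases T refl
    where
    by-cases : ∀ T₀ → T₀ ≡ T → count (λ t → Admissible? S (false ∷ t)) (allRows n) ≡ isZero (length T₀)
    by-cases []       []≡T = trans (sumL-cong (allRows n) λ t →
        𝟙-⇔ (admissible-0∷⇒zero S t)
            (λ t≡0 → subst (λ v → Admissible S (false ∷ v)) (sym t≡0) (zero-admissible S leading-zero))
            (Admissible? S (false ∷ t)) (VecP.≡-dec BoolP._≟_ t (zeroRow n)))
      (count-zeroRow n)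
      where
      leading-zero : All (λ r → lookup r zero ≡ false) S
      leading-zero = AllP.++⁺ (AllP.map⁺ (All.universal (λ _ → refl) R))
                              (subst (λ L → All _ (map (true ∷_) L)) []≡T [])
    by-cases (u ∷ T′) u∷T′≡T = sumL-zero _ (allRows n) λ t →
      𝟙-no (admissible-0∷⇒no-leading-one S t leading-one) (Admissible? S (false ∷ t))
      where
      leading-one : Any (λ r → lookup r zero ≡ true) S
      leading-one = AnyP.++⁺ʳ (map (false ∷_) R)
                      (subst (λ L → Any (λ r → lookup r zero ≡ true) (map (true ∷_) L)) u∷T′≡T (here refl))

  admissible-1∷⇒ : ∀ t → Admissible S (true ∷ t) → Admissible R t
  admissible-1∷⇒ t (co , harm) = contiguous-tail true (true ∷ t) co ,
    λ x y y≡1+x tx ty s → harm (suc x) (suc y) (cong suc y≡1+x) tx ty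
      (AnyP.map⁺ {P = λ s → lookup s (suc x) ≡ false × lookup s (suc y) ≡ true} (AnyP.++⁺ˡ s))

  admissible-1∷⇐ : All (λ u → ContiguousOnes (true ∷ u)) T → ∀ t → Admissible R t → Admissible S (true ∷ t)
  admissible-1∷⇐ coT t (co , harmR) = contiguous-1∷1∷ co , harm
    where
    harm : (x y : Fin (suc (suc n))) → toℕ y ≡ suc (toℕ x) → lookup (true ∷ true ∷ t) x ≡ true →
           lookup (true ∷ true ∷ t) y ≡ false → ¬ Any (λ s → lookup s x ≡ false × lookup s y ≡ true) (map (false ∷_) S)
    harm zero    zero          ()
    harm zero    (suc zero)    _     _  ()
    harm zero    (suc (suc y)) ()
    harm (suc x) zero          ()
    harm (suc x) (suc y)       y≡1+x tx ty s with AnyP.++⁻ (map (false ∷_) R) (AnyP.map⁻ s)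
    ... | inj₁ s∈0R = harmR x y (NP.suc-injective y≡1+x) tx ty s∈0R
    ... | inj₂ s∈1T with All.lookupAny coT (AnyP.map⁻ s∈1T)
    ...   | (cu , sx , sy) = true≢false (trans (sym (contiguous-1∷-before cu x y (NP.suc-injective y≡1+x) sy)) sx)

  admissibleCount-split : All (λ u → ContiguousOnes (true ∷ u)) T → admissibleCount S ≡ isZero (length T) + admissibleCount R
  admissibleCount-split coT = begin
      count (Admissible? S) (map (false ∷_) (allRows n) ++ map (true ∷_) (allRows n))
    ≡⟨ sumL-++ _ (map (false ∷_) (allRows n)) (map (true ∷_) (allRows n)) ⟩
      count (Admissible? S) (map (false ∷_) (allRows n)) + count (Admissible? S) (map (true ∷_) (allRows n))
    ≡⟨ cong₂ _+_ (trans (sumL-map _ (false ∷_) (allRows n)) count-admissible-0∷)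
         (trans (sumL-map _ (true ∷_) (allRows n)) (sumL-cong (allRows n) λ t →
           𝟙-⇔ (admissible-1∷⇒ t) (admissible-1∷⇐ coT t) (Admissible? S (true ∷ t)) (Admissible? R t))) ⟩
      isZero (length T) + admissibleCount R
    ∎
    where open ≡-Reasoning

nonzeroRows-suc : ∀ n → nonzeroRows (suc n) ≡ map (false ∷_) (nonzeroRows n) ++ map (true ∷_) (allRows n)
nonzeroRows-suc n = trans (ListP.filter-++ NZ? (map (false ∷_) (allRows n)) (map (true ∷_) (allRows n)))
  (cong₂ _++_ (filter-0∷ (allRows n))
              (ListP.filter-all NZ? (AllP.map⁺ (All.universal (λ r e → true≢false (cong head e)) (allRows n)))))
  where
  NZ? = λ (r : Vec Bool (suc n)) → ¬? (VecP.≡-dec BoolP._≟_ r (zeroRow (suc n)))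
  filter-0∷ : ∀ rs → filter NZ? (map (false ∷_) rs) ≡ map (false ∷_) (filter (λ r → ¬? (VecP.≡-dec BoolP._≟_ r (zeroRow n))) rs)
  filter-0∷ []       = refl
  filter-0∷ (r ∷ rs) with VecP.≡-dec BoolP._≟_ r (zeroRow n)
  ... | yes _ = filter-0∷ rs
  ... | no _  = cong ((false ∷ r) ∷_) (filter-0∷ rs)

hcoWeight : ∀ {n} → ℕ → ℕ → List (Vec Bool n) → ℕ
hcoWeight k i S = 𝟙 (HCO? S) * 𝟙 (length S ℕ.≟ k) * 𝟙 (admissibleCount S ℕ.≟ i)

hcoCount : ℕ → ℕ → ℕ → ℕ
hcoCount n k i = sumL (hcoWeight k i) (subsets (nonzeroRows n))

𝟙-product : {P Q₁ Q₂ : Set} (p : Dec P) (q₁ : Dec Q₁) (q₂ : Dec Q₂) {x y : ℕ} →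
  (P → Q₁ × Q₂) → (Q₁ → Q₂ → P) → (P → x ≡ y) → 𝟙 p * x ≡ 𝟙 q₁ * (𝟙 q₂ * y)
𝟙-product (yes p) (yes _)  (yes _)  {y = y} _ _ x≡y = cong (1 *_) (trans (x≡y p) (sym (NP.*-identityˡ y)))
𝟙-product (yes p) (no ¬q₁) _        split _ _ = ⊥-elim (¬q₁ (proj₁ (split p)))
𝟙-product (yes p) (yes _)  (no ¬q₂) split _ _ = ⊥-elim (¬q₂ (proj₂ (split p)))
𝟙-product (no ¬p) (yes q₁) (yes q₂) _ join _  = ⊥-elim (¬p (join q₁ q₂))
𝟙-product (no ¬p) (yes _)  (no _)   _ _ _     = refl
𝟙-product (no ¬p) (no _)   _        _ _ _     = refl

module _ {n : ℕ} (k i : ℕ) where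

  extensionWeight : List (Vec Bool n) → ℕ → ℕ
  extensionWeight R t = 𝟙 (length R + t ℕ.≟ k) * 𝟙 (isZero t + admissibleCount R ℕ.≟ i)

  extensionWeight-vanishes : ∀ R t → k < t → extensionWeight R t ≡ 0
  extensionWeight-vanishes R t k<t = cong (_* _)
    (𝟙-no (λ e → NP.<⇒≢ (NP.<-≤-trans k<t (NP.m≤n+m t (length R))) (sym e)) (length R + t ℕ.≟ k))

  hcoWeight-split : ∀ (R T : List (Vec Bool n)) →
    hcoWeight k i (map (false ∷_) R ++ map (true ∷_) T)
      ≡ 𝟙 (HCO? R) * (𝟙 (all? (Admissible? R) T) * extensionWeight R (length T))
  hcoWeight-split R T =
    trans (NP.*-assoc (𝟙 (HCO? S)) _ _)
          (𝟙-product (HCO? S) (HCO? R) (all? (Admissible? R) T) (HCO-split⇒ R T) (HCO-split⇐ R T) same-weight)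
    where
    S = map (false ∷_) R ++ map (true ∷_) T
    length-S : length S ≡ length R + length T
    length-S = trans (ListP.length-++ (map (false ∷_) R)) (cong₂ _+_ (ListP.length-map _ R) (ListP.length-map _ T))
    same-weight : HCO S → 𝟙 (length S ℕ.≟ k) * 𝟙 (admissibleCount S ℕ.≟ i) ≡ extensionWeight R (length T)
    same-weight hco = cong₂ _*_ (𝟙-≡ length-S k)
      (𝟙-≡ (admissibleCount-split R T (All.map proj₁ (proj₂ (HCO-split⇒ R T hco)))) i)
expand-δ : ∀ k (g : ℕ → ℕ) → (∀ t → k < t → g t ≡ 0) → ∀ t → g t ≡ sumN k (λ s → 𝟙 (t ℕ.≟ s) * g s)
expand-δ k g vanish t with t ℕ.≤? k
... | yes t≤k = sym (sumN-δ k t g t≤k)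
... | no t≰k  = trans (vanish t (NP.≰⇒> t≰k)) (sym (sumN-δ-outside k t g (NP.≰⇒> t≰k)))

sum-subsets-All : {A : Set} {Q : A → Set} (Q? : (x : A) → Dec (Q x)) (L : List A) (k : ℕ) (g : ℕ → ℕ) →
  (∀ t → k < t → g t ≡ 0) →
  sumL (λ T → 𝟙 (all? Q? T) * g (length T)) (subsets L) ≡ sumN k (λ s → binom (count Q? L) s * g s)
sum-subsets-All Q? L k g vanish = begin
    sumL (λ T → 𝟙 (all? Q? T) * g (length T)) (subsets L)
  ≡⟨ sumL-cong (subsets L) (λ T → trans (cong (𝟙 (all? Q? T) *_) (expand-δ k g vanish (length T)))
                                        (sumN-*ˡ k (𝟙 (all? Q? T)) _)) ⟩
    sumL (λ T → sumN k (λ s → 𝟙 (all? Q? T) * (𝟙 (length T ℕ.≟ s) * g s))) (subsets L)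
  ≡⟨ sumL-sumN (subsets L) k _ ⟩
    sumN k (λ s → sumL (λ T → 𝟙 (all? Q? T) * (𝟙 (length T ℕ.≟ s) * g s)) (subsets L))
  ≡⟨ sumN-cong k (λ s _ → trans (sumL-cong (subsets L) (λ T → sym (NP.*-assoc (𝟙 (all? Q? T)) _ _)))
                               (trans (sym (sumL-*ʳ (g s) _ (subsets L))) (cong (_* g s) (count-subsets-All Q? L s)))) ⟩
    sumN k (λ s → binom (count Q? L) s * g s)
  ∎
  where open ≡-Reasoning

-- the s = 0 term (T = ∅) adds an admissible row; the terms s ≥ 1 contribute
-- C(v, s) = aCoeff i s when v = i
extension-sum : ∀ k i j v →
  sumN k (λ s → binom v s * (𝟙 (j + s ℕ.≟ k) * 𝟙 (isZero s + v ℕ.≟ i)))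
    ≡ 𝟙 (j ℕ.≟ k) * 𝟙 (suc v ℕ.≟ i) + sumN k (λ s → aCoeff i s * (𝟙 (j ℕ.≟ k ∸ s) * 𝟙 (v ℕ.≟ i)))
extension-sum k i j v = trans (sumN-dropZero k _) (cong₂ _+_ term-zero (sumN-cong k terms-pos))
  where
  term-zero : 1 * (𝟙 (j + 0 ℕ.≟ k) * 𝟙 (suc v ℕ.≟ i)) ≡ 𝟙 (j ℕ.≟ k) * 𝟙 (suc v ℕ.≟ i)
  term-zero = trans (NP.*-identityˡ _) (cong (_* 𝟙 (suc v ℕ.≟ i)) (𝟙-≡ (NP.+-identityʳ j) k))
  terms-pos : ∀ s → s ≤ k → dropZero (λ s → binom v s * (𝟙 (j + s ℕ.≟ k) * 𝟙 (isZero s + v ℕ.≟ i))) s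
                             ≡ aCoeff i s * (𝟙 (j ℕ.≟ k ∸ s) * 𝟙 (v ℕ.≟ i))
  terms-pos zero    _ = refl
  terms-pos (suc s) s≤k with v ℕ.≟ i
  ... | yes refl = cong (λ z → binom v (suc s) * (z * 1))
                        (𝟙-⇔ (λ e → trans (sym (NP.m+n∸n≡m j (suc s))) (cong (_∸ suc s) e))
                             (λ e → trans (cong (_+ suc s) e) (NP.m∸n+n≡m s≤k)) (j + suc s ℕ.≟ k) (j ℕ.≟ k ∸ suc s))
  ... | no _     = trans (cong (binom v (suc s) *_) (NP.*-zeroʳ (𝟙 (j + suc s ℕ.≟ k))))
                   (trans (NP.*-zeroʳ (binom v (suc s)))
                   (sym (trans (cong (binom i (suc s) *_) (NP.*-zeroʳ (𝟙 (j ℕ.≟ k ∸ suc s)))) (NP.*-zeroʳ (binom i (suc s))))))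

-- all HCO sets 0R ∪ 1T with R fixed: either T = ∅ (one more admissible
-- row than R) or |T| = s ≥ 1 (as many admissible rows as R)
extensions-of : ∀ {n} k i (R : List (Vec Bool n)) →
  sumL (λ T → hcoWeight k i (map (false ∷_) R ++ T)) (subsets (map (true ∷_) (allRows n)))
    ≡ 𝟙 (HCO? R) * 𝟙 (length R ℕ.≟ k) * 𝟙 (suc (admissibleCount R) ℕ.≟ i)
      + sumN k (λ s → aCoeff i s * hcoWeight (k ∸ s) i R)
extensions-of {n} k i R = begin
    sumL (λ T → hcoWeight k i (map (false ∷_) R ++ T)) (subsets (map (true ∷_) (allRows n)))
  ≡⟨ sum-subsets-map _ (true ∷_) (allRows n) ⟩
    sumL (λ T → hcoWeight k i (map (false ∷_) R ++ map (true ∷_) T)) (subsets (allRows n))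
  ≡⟨ sumL-cong (subsets (allRows n)) (hcoWeight-split k i R) ⟩
    sumL (λ T → h * (𝟙 (all? (Admissible? R) T) * extensionWeight k i R (length T))) (subsets (allRows n))
  ≡⟨ sym (sumL-*ˡ h _ (subsets (allRows n))) ⟩
    h * sumL (λ T → 𝟙 (all? (Admissible? R) T) * extensionWeight k i R (length T)) (subsets (allRows n))
  ≡⟨ cong (h *_) (sum-subsets-All (Admissible? R) (allRows n) k (extensionWeight k i R) (extensionWeight-vanishes k i R)) ⟩
    h * sumN k (λ s → binom (admissibleCount R) s * extensionWeight k i R s)
  ≡⟨ cong (h *_) (extension-sum k i (length R) (admissibleCount R)) ⟩
    h * (A + sumN k (λ s → aCoeff i s * B s))
  ≡⟨ NP.*-distribˡ-+ h A _ ⟩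
    h * A + h * sumN k (λ s → aCoeff i s * B s)
  ≡⟨ cong₂ _+_ (sym (NP.*-assoc h _ _)) (trans (sumN-*ˡ k h _) (sumN-cong k λ s _ →
       trans (x∙yz≈y∙xz h (aCoeff i s) (B s)) (cong (aCoeff i s *_) (sym (NP.*-assoc h _ _))))) ⟩
    h * 𝟙 (length R ℕ.≟ k) * 𝟙 (suc (admissibleCount R) ℕ.≟ i) + sumN k (λ s → aCoeff i s * hcoWeight (k ∸ s) i R)
  ∎
  where
  open ≡-Reasoning
  open CommSemigroupProps NP.*-commutativeSemigroup using (x∙yz≈y∙xz)
  h = 𝟙 (HCO? R)
  A = 𝟙 (length R ℕ.≟ k) * 𝟙 (suc (admissibleCount R) ℕ.≟ i)
  B = λ s → 𝟙 (length R ℕ.≟ k ∸ s) * 𝟙 (admissibleCount R ℕ.≟ i)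

hcoCountBelow : ℕ → ℕ → ℕ → ℕ
hcoCountBelow n k zero    = 0
hcoCountBelow n k (suc i) = hcoCount n k i

hcoCountBelow-sum : ∀ n k i →
  sumL (λ R → 𝟙 (HCO? R) * 𝟙 (length R ℕ.≟ k) * 𝟙 (suc (admissibleCount R) ℕ.≟ i)) (subsets (nonzeroRows n))
    ≡ hcoCountBelow n k i
hcoCountBelow-sum n k zero    = sumL-zero _ (subsets (nonzeroRows n)) λ R →
  trans (cong (𝟙 (HCO? R) * 𝟙 (length R ℕ.≟ k) *_) (𝟙-no (λ ()) (suc (admissibleCount R) ℕ.≟ 0)))
        (NP.*-zeroʳ (𝟙 (HCO? R) * 𝟙 (length R ℕ.≟ k)))
hcoCountBelow-sum n k (suc i) = sumL-cong (subsets (nonzeroRows n)) λ R →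
  cong (𝟙 (HCO? R) * 𝟙 (length R ℕ.≟ k) *_)
       (𝟙-⇔ NP.suc-injective (cong suc) (suc (admissibleCount R) ℕ.≟ suc i) (admissibleCount R ℕ.≟ i))

hcoCount-suc : ∀ n k i → hcoCount (suc n) k i ≡ hcoCountBelow n k i + sumN k (λ s → aCoeff i s * hcoCount n (k ∸ s) i)
hcoCount-suc n k i = begin
    sumL (hcoWeight k i) (subsets (nonzeroRows (suc n)))
  ≡⟨ cong (λ L → sumL (hcoWeight k i) (subsets L)) (nonzeroRows-suc n) ⟩
    sumL (hcoWeight k i) (subsets (map (false ∷_) (nonzeroRows n) ++ map (true ∷_) (allRows n)))
  ≡⟨ sum-subsets-++ (hcoWeight k i) (map (false ∷_) (nonzeroRows n)) (map (true ∷_) (allRows n)) ⟩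
    sumL (λ S → sumL (λ T → hcoWeight k i (S ++ T)) (subsets (map (true ∷_) (allRows n)))) (subsets (map (false ∷_) (nonzeroRows n)))
  ≡⟨ sum-subsets-map _ (false ∷_) (nonzeroRows n) ⟩
    sumL (λ R → sumL (λ T → hcoWeight k i (map (false ∷_) R ++ T)) (subsets (map (true ∷_) (allRows n)))) (subsets (nonzeroRows n))
  ≡⟨ sumL-cong (subsets (nonzeroRows n)) (extensions-of k i) ⟩
    sumL (λ R → 𝟙 (HCO? R) * 𝟙 (length R ℕ.≟ k) * 𝟙 (suc (admissibleCount R) ℕ.≟ i)
                + sumN k (λ s → aCoeff i s * hcoWeight (k ∸ s) i R)) (subsets (nonzeroRows n))
  ≡⟨ sumL-+ _ _ (subsets (nonzeroRows n)) ⟩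
    sumL (λ R → 𝟙 (HCO? R) * 𝟙 (length R ℕ.≟ k) * 𝟙 (suc (admissibleCount R) ℕ.≟ i)) (subsets (nonzeroRows n))
      + sumL (λ R → sumN k (λ s → aCoeff i s * hcoWeight (k ∸ s) i R)) (subsets (nonzeroRows n))
  ≡⟨ cong₂ _+_ (hcoCountBelow-sum n k i)
       (trans (sumL-sumN (subsets (nonzeroRows n)) k _)
              (sumN-cong k λ s _ → sym (sumL-*ˡ (aCoeff i s) (hcoWeight (k ∸ s) i) (subsets (nonzeroRows n))))) ⟩
    hcoCountBelow n k i + sumN k (λ s → aCoeff i s * hcoCount n (k ∸ s) i)
  ∎
  where open ≡-Reasoning

-- no columns: only the empty set, whose single admissible row is (1)
hcoCount-zero : ∀ k i → hcoCount 0 k i ≡ D 0 i k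
hcoCount-zero k i = trans (cong (_+ 0) (cong₂ (λ h a → h * 𝟙 (0 ℕ.≟ k) * a) (𝟙-yes hco-empty (HCO? []))
                                               (𝟙-≡ one-admissible i)))
                          (by-cases k i)
  where
  hco-empty : HCO {0} []
  hco-empty = [] , λ { _ _ _ (() , _) }
  admissible-empty : Admissible {0} [] []
  admissible-empty = (λ { zero zero zero _ _ _ _ → refl }) , λ { zero zero () }
  one-admissible : admissibleCount {0} [] ≡ 1
  one-admissible = cong (_+ 0) (𝟙-yes admissible-empty (Admissible? [] []))
  by-cases : ∀ k i → 1 * 𝟙 (0 ℕ.≟ k) * 𝟙 (1 ℕ.≟ i) + 0 ≡ D 0 i k
  by-cases zero    zero          = refl
  by-cases zero    (suc zero)    = refl
  by-cases zero    (suc (suc i)) = refl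
  by-cases (suc k) zero          = refl
  by-cases (suc k) (suc zero)    = refl
  by-cases (suc k) (suc (suc i)) = refl

hcoCount≡D : ∀ n k i → hcoCount n k i ≡ D n i k
hcoCount≡D zero    k i       = hcoCount-zero k i
hcoCount≡D (suc n) k zero    = trans (hcoCount-suc n k 0) (sumN-cong k λ s _ → cong (aCoeff 0 s *_) (hcoCount≡D n (k ∸ s) 0))
hcoCount≡D (suc n) k (suc i) = trans (hcoCount-suc n k (suc i))
  (cong₂ _+_ (hcoCount≡D n k i) (sumN-cong k λ s _ → cong (aCoeff (suc i) s *_) (hcoCount≡D n (k ∸ s) (suc i))))

-- every set has at most length (allRows n) admissible rows
c≡sum-hcoCount : ∀ n k M → length (allRows n) ≤ M → c n k ≡ sumN M (hcoCount n k)
c≡sum-hcoCount n k M bound = begin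
    length (filter HCO? (combinations k (nonzeroRows n)))
  ≡⟨ length-filter HCO? (combinations k (nonzeroRows n)) ⟩
    sumL (λ S → 𝟙 (HCO? S)) (combinations k (nonzeroRows n))
  ≡⟨ sum-combinations k (nonzeroRows n) (λ S → 𝟙 (HCO? S)) ⟩
    sumL (λ S → 𝟙 (length S ℕ.≟ k) * 𝟙 (HCO? S)) (subsets (nonzeroRows n))
  ≡⟨ sumL-cong (subsets (nonzeroRows n)) spread ⟩
    sumL (λ S → sumN M (λ i → hcoWeight k i S)) (subsets (nonzeroRows n))
  ≡⟨ sumL-sumN (subsets (nonzeroRows n)) M (λ S i → hcoWeight k i S) ⟩
    sumN M (hcoCount n k)
  ∎
  where
  open ≡-Reasoning
  spread : ∀ S → 𝟙 (length S ℕ.≟ k) * 𝟙 (HCO? S) ≡ sumN M (λ i → hcoWeight k i S)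
  spread S = sym (begin
      sumN M (λ i → 𝟙 (HCO? S) * 𝟙 (length S ℕ.≟ k) * 𝟙 (admissibleCount S ℕ.≟ i))
    ≡⟨ sumN-cong M (λ i _ → NP.*-comm (𝟙 (HCO? S) * 𝟙 (length S ℕ.≟ k)) _) ⟩
      sumN M (λ i → 𝟙 (admissibleCount S ℕ.≟ i) * (𝟙 (HCO? S) * 𝟙 (length S ℕ.≟ k)))
    ≡⟨ sumN-δ M (admissibleCount S) _ (NP.≤-trans (count≤length (Admissible? S) (allRows n)) bound) ⟩
      𝟙 (HCO? S) * 𝟙 (length S ℕ.≟ k)
    ≡⟨ NP.*-comm (𝟙 (HCO? S)) _ ⟩
      𝟙 (length S ℕ.≟ k) * 𝟙 (HCO? S)
    ∎)

-- D n 0 = 0 and D n i = 0 for i > n + 1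
sum-D-over-index : ∀ n k M → n ≤ M → sumN (suc M) (λ i → D n i k) ≡ sumN n (λ m → D n (suc m) k)
sum-D-over-index n k M n≤M = begin
    sumN (suc M) (λ i → D n i k)                 ≡⟨ sumN-shift M (λ i → D n i k) ⟩
    D n 0 k + sumN M (λ m → D n (suc m) k)      ≡⟨ cong (_+ sumN M (λ m → D n (suc m) k)) (D-index-zero n k) ⟩
    sumN M (λ m → D n (suc m) k)                ≡⟨ sumN-extend M n (λ m → D n (suc m) k) n≤M (λ m n<m → D-index-large n (suc m) k (s≤s n<m)) ⟩
    sumN n (λ m → D n (suc m) k)                ∎
  where open ≡-Reasoning

theorem5p2 : (n k : ℕ) → lhs n k ≡ rhs n k
theorem5p2 n k = begin
    lhs n k                                ≡⟨ cong +_ (c≡sum-hcoCount n k M (NP.m≤n⇒m≤1+n (NP.m≤m+n _ n))) ⟩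
    + sumN M (hcoCount n k)                ≡⟨ cong +_ (sumN-cong M λ i _ → hcoCount≡D n k i) ⟩
    + sumN M (λ i → D n i k)               ≡⟨ cong +_ (sum-D-over-index n k (length (allRows n) + n) (NP.m≤n+m n _)) ⟩
    + sumN n (λ m → D n (suc m) k)         ≡⟨ sym (rhs-coeff n k) ⟩
    rhs n k                                ∎
  where
  open ≡-Reasoning
  M = suc (length (allRows n) + n)
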